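{- Let $m\ge2$, $k\ge1$, $g\ge0$, $n=m+g(m-1)$, and let $D,D'$ be $(m-1)$-Dyck paths of length $n-1$. Then $D$ and $D'$ are $k$-equivalent if and only if $d(D)\equiv d(D')\pmod{k(m-1)}$ componentwise.
   Context: $N$ denotes the unit step $(1,1)$, $S$ the step $(1,-1)$; lattice paths are identified with words in $N,S$. An $(m-1)$-Dyck path is a lattice path from $(0,0)$ with up-steps $(m-1,m-1)$ and down-steps $(1,-1)$, never below the $x$-axis and ending on it; its length is its number of down-steps. Each $(m-1)$-Dyck path $D$ of length $n-1$ is uniquely written $N^{d_1}SN^{d_2}S\dots SN^{d_{n-1}}SN^{d_n}$ with $d_i$ non-negative multiples of $m-1$ and $d_n=0$; $d(D):=(d_1,\dots,d_n)$. Right $k$-compression: replace a consecutive subword $X=N^{m-1}D_1SD_2S\dots D_{j-1}SN^{k(m-1)}D_jSD_{j+1}S\dots SD_{m+k(m-1)}$ ($1\le j\le m-1$, each $D_i$ a possibly empty word that is an $(m-1)$-Dyck path up to translation) by $X'=N^{m-1}D_1S\dots D_{j-1}SD_jSN^{k(m-1)}D_{j+1}S\dots SD_{m+k(m-1)}$; left $k$-compression is the inverse. Two paths are $k$-equivalent if one is obtained from the other by a finite sequence of right and left $k$-compressions. -}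

module Defs where

open import Data.Nat using (ℕ; zero; suc; _+_; _*_; _∸_; _≤_)
open import Data.Nat.Base using (∣_-_∣)
open import Data.Nat.Divisibility using (_∣_)
open import Data.List using (List; []; _∷_; _++_; replicate; length)
open import Data.List.Relation.Binary.Pointwise using (Pointwise)
open import Data.Product using (Σ; _×_; ∃; _,_)
open import Data.Empty using (⊥)
open import Relation.Binary.PropositionalEquality using (_≡_)
open import Relation.Binary.Construct.Closure.Equivalence using (EqClosure)
open import Data.List.Relation.Unary.All using (All)

-- Unit steps: N = (1,1), S = (1,-1). Lattice paths are words.
data Step : Set where
  N S : Step

Word : Set
Word = List Step

-- "Big" steps of an r-Dyck path: up-step (r,r) and down-step (1,-1).
data BigStep : Set where
  U Dn : BigStep

flatten : ℕ → List BigStep → Word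
flatten r []        = []
flatten r (U ∷ bs)  = replicate r N ++ flatten r bs
flatten r (Dn ∷ bs) = S ∷ flatten r bs

Ballot : ℕ → ℕ → List BigStep → Set
Ballot r h       []        = h ≡ 0
Ballot r h       (U ∷ bs)  = Ballot r (h + r) bs
Ballot r zero    (Dn ∷ bs) = ⊥
Ballot r (suc h) (Dn ∷ bs) = Ballot r h bs

-- w is an r-Dyck path (from height 0; "up to translation" for subwords).
IsDyck : ℕ → Word → Set
IsDyck r w = Σ (List BigStep) λ bs → flatten r bs ≡ w × Ballot r 0 bs

-- number of S steps (= length of a Dyck path)
numS : Word → ℕ
numS []      = 0
numS (N ∷ w) = numS w
numS (S ∷ w) = suc (numS w)

incHead : List ℕ → List ℕ
incHead []      = []
incHead (x ∷ l) = suc x ∷ l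

-- d(D) = (d_1,…,d_n) where D = N^{d_1} S N^{d_2} S … S N^{d_n}
dseq : Word → List ℕ
dseq []      = 0 ∷ []
dseq (N ∷ w) = incHead (dseq w)
dseq (S ∷ w) = 0 ∷ dseq w

joinS : List Word → Word
joinS []           = []
joinS (x ∷ [])     = x
joinS (x ∷ y ∷ ws) = x ++ S ∷ joinS (y ∷ ws)

-- One right k-compression step (parameter m): X ↦ X' inside a word.
-- before = D_1 … D_{j-1}, Dj = D_j, Dj1 = D_{j+1}, rest = D_{j+2} … D_{m+k(m-1)}.
data RightComp (m k : ℕ) : Word → Word → Set where
  rcomp : (u v : Word) (before : List Word) (Dj Dj1 : Word) (rest : List Word) →
          length before + 2 ≤ m →
          length before + 2 + length rest ≡ m + k * (m ∸ 1) →
          All (IsDyck (m ∸ 1)) before → IsDyck (m ∸ 1) Dj →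
          IsDyck (m ∸ 1) Dj1 → All (IsDyck (m ∸ 1)) rest →
          RightComp m k
            (u ++ (replicate (m ∸ 1) N ++
               joinS (before ++ (replicate (k * (m ∸ 1)) N ++ Dj) ∷ Dj1 ∷ rest)) ++ v)
            (u ++ (replicate (m ∸ 1) N ++
               joinS (before ++ Dj ∷ (replicate (k * (m ∸ 1)) N ++ Dj1) ∷ rest)) ++ v)

KEquiv : ℕ → ℕ → Word → Word → Set
KEquiv m k = EqClosure (RightComp m k)

_≡_[mod_] : ℕ → ℕ → ℕ → Set
a ≡ b [mod q ] = q ∣ ∣ a - b ∣

module Submission where

-- A right k-compression turns  u N^K v S w  into  u v S N^K w  (K = k(m−1)): it moves K from one entry of
-- d(D) to a later one. So the residues of d(D) mod K are invariant, and the number of pairs S … N strictly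
-- increases. Conversely, left compressions decrease that number, so applying them while possible reaches a
-- path on which none applies; there every d_i with i ≥ 2 is < K, since if d_i ≥ K the S before N^{d_i} ends a
-- Dyck factor inside the return of some up-step, and N^K can be moved in front of that factor. Such a normal
-- path is determined by the residues: the entries after the first are the residues themselves, and the first
-- is then fixed because the entries sum to the number of down-steps. Paths with equal residues thus share a
-- normal form.

open import Defs
open import Data.Nat using (ℕ; zero; suc; _+_; _*_; _∸_; _≤_; _<_; z≤n; s≤s; NonZero; _≤?_)
open import Data.Nat.Properties
open import Data.Nat.DivMod using (_%_; _/_; [m+kn]%n≡m%n; [m+n]%n≡m%n; m≡m%n+[m/n]*n; m<n⇒m%n≡m)
open import Data.Nat.Divisibility using (_∣_; divides)
open import Data.Nat.ListAction using (sum)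
open import Data.List using (List; []; _∷_; _++_; [_]; replicate; length; map; intercalate; concatMap; foldr)
open import Data.List.Properties using (∷-injectiveʳ; length-++-≤ˡ; length-++-≤ʳ; ++-assoc; ++-identityʳ; map-++; length-map; length-++; concatMap-++; ++-monoid)
open import Data.List.Relation.Unary.All as All using (All; []; _∷_)
open import Data.List.Relation.Unary.All.Properties as All using (++⁺; ++⁻ˡ; ++⁻ʳ)
open import Data.List.Relation.Binary.Pointwise as PW using (Pointwise; []; _∷_)
open import Data.Product using (_×_; ∃-syntax; _,_)
open import Data.Sum using (_⊎_; inj₁; inj₂)
open import Data.Empty using (⊥)
open import Relation.Nullary using (yes; no)
open import Induction.WellFounded using (Acc; acc)
open import Data.Nat.Induction using (<-wellFounded)
open import Data.List.Relation.Unary.Any using (Any; here; there)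
open import Data.List.Membership.Propositional using (find)
open import Data.List.Membership.Propositional.Properties using (∈-∃++)
open import Relation.Binary.Construct.Closure.ReflexiveTransitive using (ε; _◅_; _◅◅_)
open import Relation.Binary.Construct.Closure.Symmetric using (bwd)
open import Data.Unit using (⊤; tt)
open import Relation.Binary.Construct.Closure.Equivalence as EQ using ()
open import Function.Bundles using (_⇔_; mk⇔; Equivalence)
open import Relation.Binary.PropositionalEquality using (_≡_; refl; sym; trans; cong; cong₂; subst; subst₂; isEquivalence; module ≡-Reasoning)
open import Algebra.Properties.CommutativeSemigroup +-commutativeSemigroup using (x∙yz≈y∙xz; xy∙z≈xz∙y; x∙yz≈xz∙y)
open import Algebra.Solver.Monoid (++-monoid Step) using (solve; _⊜_; _⊕_)

module _ {q : ℕ} .{{_ : NonZero q}} where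

  ∣∸⇒%≡ : ∀ {a b} → a ≤ b → q ∣ b ∸ a → a % q ≡ b % q
  ∣∸⇒%≡ {a} {b} a≤b (divides c b∸a≡cq) = begin
    a % q             ≡⟨ [m+kn]%n≡m%n a c q ⟨
    (a + c * q) % q   ≡⟨ cong (λ t → (a + t) % q) b∸a≡cq ⟨
    (a + (b ∸ a)) % q ≡⟨ cong (_% q) (m+[n∸m]≡n a≤b) ⟩
    b % q             ∎
    where open ≡-Reasoning

  %≡⇒∣∸ : ∀ {a b} → a % q ≡ b % q → q ∣ b ∸ a
  %≡⇒∣∸ {a} {b} a%q≡b%q = divides (b / q ∸ a / q) (begin
    b ∸ a                                     ≡⟨ cong₂ _∸_ (m≡m%n+[m/n]*n b q) (m≡m%n+[m/n]*n a q) ⟩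
    (b % q + b / q * q) ∸ (a % q + a / q * q) ≡⟨ cong (λ t → (b % q + b / q * q) ∸ (t + a / q * q)) a%q≡b%q ⟩
    (b % q + b / q * q) ∸ (b % q + a / q * q) ≡⟨ [m+n]∸[m+o]≡n∸o (b % q) _ _ ⟩
    b / q * q ∸ a / q * q                     ≡⟨ *-distribʳ-∸ q (b / q) (a / q) ⟨
    (b / q ∸ a / q) * q                       ∎)
    where open ≡-Reasoning

  ≡[mod]⇒%≡ : ∀ {a b} → a ≡ b [mod q ] → a % q ≡ b % q
  ≡[mod]⇒%≡ {a} {b} q∣∣a-b∣ with ≤-total a b
  ... | inj₁ a≤b = ∣∸⇒%≡ a≤b (subst (q ∣_) (m≤n⇒∣m-n∣≡n∸m a≤b) q∣∣a-b∣)
  ... | inj₂ b≤a = sym (∣∸⇒%≡ b≤a (subst (q ∣_) (m≤n⇒∣n-m∣≡n∸m b≤a) q∣∣a-b∣))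

  %≡⇒≡[mod] : ∀ {a b} → a % q ≡ b % q → a ≡ b [mod q ]
  %≡⇒≡[mod] {a} {b} a%q≡b%q with ≤-total a b
  ... | inj₁ a≤b = subst (q ∣_) (sym (m≤n⇒∣m-n∣≡n∸m a≤b)) (%≡⇒∣∸ a%q≡b%q)
  ... | inj₂ b≤a = subst (q ∣_) (sym (m≤n⇒∣n-m∣≡n∸m b≤a)) (%≡⇒∣∸ (sym a%q≡b%q))

  Pointwise-≡[mod]⇔map-% : ∀ {xs ys} →
    Pointwise (λ a b → a ≡ b [mod q ]) xs ys ⇔ map (_% q) xs ≡ map (_% q) ys
  Pointwise-≡[mod]⇔map-% = mk⇔
    (λ xs≈ys → PW.Pointwise-≡⇒≡ (PW.map⁺ (_% q) (_% q) (PW.map ≡[mod]⇒%≡ xs≈ys)))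
    (λ eq → PW.map %≡⇒≡[mod] (PW.map⁻ (_% q) (_% q) (PW.≡⇒Pointwise-≡ eq)))

  map-%-small : ∀ {xs} → All (_< q) xs → map (_% q) xs ≡ xs
  map-%-small []         = refl
  map-%-small (x<q ∷ xs) = cong₂ _∷_ (m<n⇒m%n≡m x<q) (map-%-small xs)

module _ {a} {A : Set a} (x : A) where

  sepAfter : List (List A) → List A
  sepAfter = foldr (λ c t → c ++ x ∷ t) []

  intercalate-∷ : ∀ c Cs → intercalate [ x ] (c ∷ Cs) ≡ c ++ concatMap (x ∷_) Cs
  intercalate-∷ c []       = sym (++-identityʳ c)
  intercalate-∷ c (d ∷ Cs) = cong (λ t → c ++ x ∷ t) (intercalate-∷ d Cs)

  intercalate-++-∷ : ∀ As c Cs →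
    intercalate [ x ] (As ++ c ∷ Cs) ≡ sepAfter As ++ intercalate [ x ] (c ∷ Cs)
  intercalate-++-∷ []            c Cs = refl
  intercalate-++-∷ (b ∷ [])      c Cs = sym (++-assoc b [ x ] _)
  intercalate-++-∷ (b ∷ b′ ∷ As) c Cs = begin
    b ++ x ∷ intercalate [ x ] (b′ ∷ As ++ c ∷ Cs)            ≡⟨ cong (λ t → b ++ x ∷ t) (intercalate-++-∷ (b′ ∷ As) c Cs) ⟩
    b ++ x ∷ sepAfter (b′ ∷ As) ++ intercalate [ x ] (c ∷ Cs) ≡⟨ ++-assoc b (x ∷ sepAfter (b′ ∷ As)) _ ⟨
    sepAfter (b ∷ b′ ∷ As) ++ intercalate [ x ] (c ∷ Cs)      ∎
    where open ≡-Reasoning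

  intercalate-++ˡ : ∀ p c Cs → intercalate [ x ] ((p ++ c) ∷ Cs) ≡ p ++ intercalate [ x ] (c ∷ Cs)
  intercalate-++ˡ p c Cs = begin
    intercalate [ x ] ((p ++ c) ∷ Cs)  ≡⟨ intercalate-∷ (p ++ c) Cs ⟩
    (p ++ c) ++ concatMap (x ∷_) Cs    ≡⟨ ++-assoc p c _ ⟩
    p ++ c ++ concatMap (x ∷_) Cs      ≡⟨ cong (p ++_) (intercalate-∷ c Cs) ⟨
    p ++ intercalate [ x ] (c ∷ Cs)    ∎
    where open ≡-Reasoning

  intercalate-nested : ∀ c Cs Ds →
    intercalate [ x ] (intercalate [ x ] (c ∷ Cs) ∷ Ds) ≡ intercalate [ x ] (c ∷ Cs ++ Ds)
  intercalate-nested c Cs Ds = begin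
    intercalate [ x ] (intercalate [ x ] (c ∷ Cs) ∷ Ds)          ≡⟨ intercalate-∷ _ Ds ⟩
    intercalate [ x ] (c ∷ Cs) ++ concatMap (x ∷_) Ds            ≡⟨ cong (_++ concatMap (x ∷_) Ds) (intercalate-∷ c Cs) ⟩
    (c ++ concatMap (x ∷_) Cs) ++ concatMap (x ∷_) Ds            ≡⟨ ++-assoc c _ _ ⟩
    c ++ concatMap (x ∷_) Cs ++ concatMap (x ∷_) Ds              ≡⟨ cong (c ++_) (concatMap-++ (x ∷_) Cs Ds) ⟨
    c ++ concatMap (x ∷_) (Cs ++ Ds)                             ≡⟨ intercalate-∷ c (Cs ++ Ds) ⟨
    intercalate [ x ] (c ∷ Cs ++ Ds)                             ∎
    where open ≡-Reasoning

  intercalate-regroup : ∀ As c p d Ds Bs →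
    intercalate [ x ] (As ++ c ∷ (p ++ intercalate [ x ] (d ∷ Ds)) ∷ Bs) ≡
    intercalate [ x ] (As ++ c ∷ (p ++ d) ∷ Ds ++ Bs)
  intercalate-regroup As c p d Ds Bs = begin
    intercalate [ x ] (As ++ c ∷ (p ++ intercalate [ x ] (d ∷ Ds)) ∷ Bs)
      ≡⟨ intercalate-++-∷ As c _ ⟩
    sepAfter As ++ c ++ x ∷ intercalate [ x ] ((p ++ intercalate [ x ] (d ∷ Ds)) ∷ Bs)
      ≡⟨ cong (λ t → sepAfter As ++ c ++ x ∷ t) (trans (intercalate-++ˡ p _ Bs) (cong (p ++_) (intercalate-nested d Ds Bs))) ⟩
    sepAfter As ++ c ++ x ∷ p ++ intercalate [ x ] (d ∷ Ds ++ Bs)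
      ≡⟨ cong (λ t → sepAfter As ++ c ++ x ∷ t) (intercalate-++ˡ p d (Ds ++ Bs)) ⟨
    sepAfter As ++ c ++ x ∷ intercalate [ x ] ((p ++ d) ∷ Ds ++ Bs)
      ≡⟨ intercalate-++-∷ As c _ ⟨
    intercalate [ x ] (As ++ c ∷ (p ++ d) ∷ Ds ++ Bs)
      ∎
    where open ≡-Reasoning

replicate-+ : ∀ {a} {A : Set a} i j (x : A) → replicate (i + j) x ≡ replicate i x ++ replicate j x
replicate-+ zero    j x = refl
replicate-+ (suc i) j x = cong (x ∷_) (replicate-+ i j x)

joinS≡intercalate : ∀ ws → joinS ws ≡ intercalate [ S ] ws
joinS≡intercalate []           = refl
joinS≡intercalate (w ∷ [])     = refl
joinS≡intercalate (w ∷ v ∷ ws) = cong (λ t → w ++ S ∷ t) (joinS≡intercalate (v ∷ ws))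

numN : Word → ℕ
numN []      = 0
numN (N ∷ w) = suc (numN w)
numN (S ∷ w) = numN w

-- Counts the pairs S … N; a right compression moves N's rightwards past an S, so it strictly increases.
inversions : Word → ℕ
inversions []      = 0
inversions (N ∷ w) = inversions w
inversions (S ∷ w) = numN w + inversions w

numS-++ : ∀ u v → numS (u ++ v) ≡ numS u + numS v
numS-++ []      v = refl
numS-++ (N ∷ u) v = numS-++ u v
numS-++ (S ∷ u) v = cong suc (numS-++ u v)

numS-insertN : ∀ u c v → numS (u ++ replicate c N ++ v) ≡ numS (u ++ v)
numS-insertN []      zero    v = refl
numS-insertN []      (suc c) v = numS-insertN [] c v
numS-insertN (N ∷ u) c       v = numS-insertN u c v
numS-insertN (S ∷ u) c       v = cong suc (numS-insertN u c v)

numN-insertN : ∀ u c v → numN (u ++ replicate c N ++ v) ≡ c + numN (u ++ v)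
numN-insertN []      zero    v = refl
numN-insertN []      (suc c) v = cong suc (numN-insertN [] c v)
numN-insertN (N ∷ u) c       v = trans (cong suc (numN-insertN u c v)) (sym (+-suc c _))
numN-insertN (S ∷ u) c       v = numN-insertN u c v

inversions-insertN : ∀ u c v → inversions (u ++ replicate c N ++ v) ≡ numS u * c + inversions (u ++ v)
inversions-insertN []      zero    v = refl
inversions-insertN []      (suc c) v = inversions-insertN [] c v
inversions-insertN (N ∷ u) c       v = inversions-insertN u c v
inversions-insertN (S ∷ u) c       v = begin
  numN (u ++ replicate c N ++ v) + inversions (u ++ replicate c N ++ v)
    ≡⟨ cong₂ _+_ (numN-insertN u c v) (inversions-insertN u c v) ⟩
  (c + numN (u ++ v)) + (numS u * c + inversions (u ++ v))
    ≡⟨ +-assoc c _ _ ⟩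
  c + (numN (u ++ v) + (numS u * c + inversions (u ++ v)))
    ≡⟨ cong (c +_) (x∙yz≈y∙xz (numN (u ++ v)) (numS u * c) _) ⟩
  c + (numS u * c + (numN (u ++ v) + inversions (u ++ v)))
    ≡⟨ +-assoc c _ _ ⟨
  suc (numS u) * c + (numN (u ++ v) + inversions (u ++ v))
    ∎
  where open ≡-Reasoning

addAt : ℕ → ℕ → List ℕ → List ℕ
addAt i       c []      = []
addAt zero    c (x ∷ l) = c + x ∷ l
addAt (suc i) c (x ∷ l) = x ∷ addAt i c l

addAt-zero : ∀ i l → addAt i 0 l ≡ l
addAt-zero i       []      = refl
addAt-zero zero    (x ∷ l) = refl
addAt-zero (suc i) (x ∷ l) = cong (x ∷_) (addAt-zero i l)

incHead-addAt : ∀ i c l → incHead (addAt i c l) ≡ addAt i c (incHead l)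
incHead-addAt i       c []      = refl
incHead-addAt zero    c (x ∷ l) = cong (_∷ l) (sym (+-suc c x))
incHead-addAt (suc i) c (x ∷ l) = refl

incHead-addAt₀ : ∀ c l → incHead (addAt 0 c l) ≡ addAt 0 (suc c) l
incHead-addAt₀ c []      = refl
incHead-addAt₀ c (x ∷ l) = refl

dseq-insertN : ∀ u c v → dseq (u ++ replicate c N ++ v) ≡ addAt (numS u) c (dseq (u ++ v))
dseq-insertN []      zero    v = sym (addAt-zero 0 (dseq v))
dseq-insertN []      (suc c) v = trans (cong incHead (dseq-insertN [] c v)) (incHead-addAt₀ c (dseq v))
dseq-insertN (N ∷ u) c       v = trans (cong incHead (dseq-insertN u c v)) (incHead-addAt (numS u) c _)
dseq-insertN (S ∷ u) c       v = cong (0 ∷_) (dseq-insertN u c v)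

dseq-∷ : ∀ w → ∃[ x ] ∃[ l ] dseq w ≡ x ∷ l
dseq-∷ []      = 0 , [] , refl
dseq-∷ (N ∷ w) with dseq-∷ w
... | x , l , eq = suc x , l , cong incHead eq
dseq-∷ (S ∷ w) = 0 , dseq w , refl

length-incHead : ∀ l → length (incHead l) ≡ length l
length-incHead []      = refl
length-incHead (x ∷ l) = refl

length-dseq : ∀ w → length (dseq w) ≡ suc (numS w)
length-dseq []      = refl
length-dseq (N ∷ w) = trans (length-incHead (dseq w)) (length-dseq w)
length-dseq (S ∷ w) = cong suc (length-dseq w)

sum-dseq : ∀ w → sum (dseq w) ≡ numN w
sum-dseq []      = refl
sum-dseq (N ∷ w) with dseq-∷ w | sum-dseq w
... | x , l , eq | ih rewrite eq = cong suc ih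
sum-dseq (S ∷ w) = sum-dseq w

undseq : List ℕ → Word
undseq []          = []
undseq (x ∷ [])    = replicate x N
undseq (x ∷ y ∷ l) = replicate x N ++ S ∷ undseq (y ∷ l)

undseq-dseq : ∀ w → undseq (dseq w) ≡ w
undseq-dseq []      = refl
undseq-dseq (N ∷ w) with dseq-∷ w | undseq-dseq w
... | x , []    , eq | ih rewrite eq = cong (N ∷_) ih
... | x , _ ∷ _ , eq | ih rewrite eq = cong (N ∷_) ih
undseq-dseq (S ∷ w) with dseq-∷ w | undseq-dseq w
... | x , l , eq | ih rewrite eq = cong (S ∷_) ih

dseq-injective : ∀ {u v} → dseq u ≡ dseq v → u ≡ v
dseq-injective {u} {v} eq = trans (sym (undseq-dseq u)) (trans (cong undseq eq) (undseq-dseq v))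

rightComp-shape : ∀ {m k x y} → RightComp m k x y →
  ∃[ u ] ∃[ v ] ∃[ w ] x ≡ u ++ replicate (k * (m ∸ 1)) N ++ v ++ S ∷ w
                     × y ≡ (u ++ v ++ [ S ]) ++ replicate (k * (m ∸ 1)) N ++ w
rightComp-shape {m} {k} (rcomp u v before Dj Dj1 rest _ _ _ _ _ _) =
  u ++ Nm ++ P , Dj , J ++ v , x-shape , y-shape
  where
  Nm NK P J s : Word
  Nm = replicate (m ∸ 1) N
  NK = replicate (k * (m ∸ 1)) N
  P  = sepAfter S before
  J  = intercalate [ S ] (Dj1 ∷ rest)
  s  = [ S ]

  joinS-split : ∀ c Cs → joinS (before ++ c ∷ Cs) ≡ P ++ intercalate [ S ] (c ∷ Cs)
  joinS-split c Cs = trans (joinS≡intercalate (before ++ c ∷ Cs)) (intercalate-++-∷ S before c Cs)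

  x-shape : u ++ (Nm ++ joinS (before ++ (NK ++ Dj) ∷ Dj1 ∷ rest)) ++ v ≡ (u ++ Nm ++ P) ++ NK ++ Dj ++ S ∷ J ++ v
  x-shape = trans (cong (λ t → u ++ (Nm ++ t) ++ v) (joinS-split (NK ++ Dj) (Dj1 ∷ rest)))
    (solve 8 (λ u Nm P NK Dj s J v → (u ⊕ (Nm ⊕ (P ⊕ ((NK ⊕ Dj) ⊕ (s ⊕ J)))) ⊕ v)
                                    ⊜ ((u ⊕ Nm ⊕ P) ⊕ NK ⊕ Dj ⊕ s ⊕ (J ⊕ v))) refl u Nm P NK Dj s J v)

  y-shape : u ++ (Nm ++ joinS (before ++ Dj ∷ (NK ++ Dj1) ∷ rest)) ++ v ≡ ((u ++ Nm ++ P) ++ Dj ++ s) ++ NK ++ J ++ v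
  y-shape = trans (cong (λ t → u ++ (Nm ++ t) ++ v)
                    (trans (joinS-split Dj ((NK ++ Dj1) ∷ rest))
                           (cong (λ t → P ++ Dj ++ S ∷ t) (intercalate-++ˡ S NK Dj1 rest))))
    (solve 8 (λ u Nm P NK Dj s J v → (u ⊕ (Nm ⊕ (P ⊕ (Dj ⊕ (s ⊕ (NK ⊕ J))))) ⊕ v)
                                    ⊜ (((u ⊕ Nm ⊕ P) ⊕ Dj ⊕ s) ⊕ NK ⊕ (J ⊕ v))) refl u Nm P NK Dj s J v)

rightComp-context : ∀ {m k x y} p q → RightComp m k x y → RightComp m k (p ++ x ++ q) (p ++ y ++ q)
rightComp-context {m} {k} p q (rcomp u v before Dj Dj1 rest ℓ₁ ℓ₂ d₁ d₂ d₃ d₄) =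
  subst₂ (RightComp m k) (reassoc _) (reassoc _) (rcomp (p ++ u) (v ++ q) before Dj Dj1 rest ℓ₁ ℓ₂ d₁ d₂ d₃ d₄)
  where
  reassoc : ∀ X → (p ++ u) ++ X ++ (v ++ q) ≡ p ++ (u ++ X ++ v) ++ q
  reassoc X = solve 5 (λ p u X v q → ((p ⊕ u) ⊕ X ⊕ (v ⊕ q)) ⊜ (p ⊕ (u ⊕ X ⊕ v) ⊕ q)) refl p u X v q

rightComp-whole : ∀ {m k} before Dj Dj1 rest →
  length before + 2 ≤ m → length before + 2 + length rest ≡ m + k * (m ∸ 1) →
  All (IsDyck (m ∸ 1)) before → IsDyck (m ∸ 1) Dj → IsDyck (m ∸ 1) Dj1 → All (IsDyck (m ∸ 1)) rest →
  RightComp m k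
    (replicate (m ∸ 1) N ++ intercalate [ S ] (before ++ (replicate (k * (m ∸ 1)) N ++ Dj) ∷ Dj1 ∷ rest))
    (replicate (m ∸ 1) N ++ intercalate [ S ] (before ++ Dj ∷ (replicate (k * (m ∸ 1)) N ++ Dj1) ∷ rest))
rightComp-whole {m} {k} before Dj Dj1 rest ℓ₁ ℓ₂ d₁ d₂ d₃ d₄ =
  subst₂ (RightComp m k) (unwrap (before ++ (NK ++ Dj) ∷ Dj1 ∷ rest)) (unwrap (before ++ Dj ∷ (NK ++ Dj1) ∷ rest))
    (rcomp [] [] before Dj Dj1 rest ℓ₁ ℓ₂ d₁ d₂ d₃ d₄)
  where
  NK : Word
  NK = replicate (k * (m ∸ 1)) N
  unwrap : ∀ ws → (replicate (m ∸ 1) N ++ joinS ws) ++ [] ≡ replicate (m ∸ 1) N ++ intercalate [ S ] ws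
  unwrap ws = trans (++-identityʳ _) (cong (replicate (m ∸ 1) N ++_) (joinS≡intercalate ws))

residues : (q : ℕ) .{{_ : NonZero q}} → Word → List ℕ
residues q w = map (_% q) (dseq w)

module _ {q : ℕ} .{{_ : NonZero q}} where

  map-%-addAt : ∀ i l → map (_% q) (addAt i q l) ≡ map (_% q) l
  map-%-addAt i       []      = refl
  map-%-addAt zero    (x ∷ l) = cong (_∷ map (_% q) l) (trans (cong (_% q) (+-comm q x)) ([m+n]%n≡m%n x q))
  map-%-addAt (suc i) (x ∷ l) = cong ((x % q) ∷_) (map-%-addAt i l)

  residues-insertN : ∀ u v → residues q (u ++ replicate q N ++ v) ≡ residues q (u ++ v)
  residues-insertN u v = trans (cong (map (_% q)) (dseq-insertN u q v)) (map-%-addAt (numS u) (dseq (u ++ v)))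

module _ {m k : ℕ} .{{_ : NonZero (k * (m ∸ 1))}} where

  private
    K : ℕ
    K = k * (m ∸ 1)

    regroup : ∀ u v w → (u ++ v ++ [ S ]) ++ w ≡ u ++ v ++ S ∷ w
    regroup u v w = trans (++-assoc u (v ++ [ S ]) w) (cong (u ++_) (++-assoc v [ S ] w))

  rightComp-residues : ∀ {x y} → RightComp m k x y → residues K x ≡ residues K y
  rightComp-residues rc with rightComp-shape rc
  ... | u , v , w , refl , refl = begin
    residues K (u ++ replicate K N ++ v ++ S ∷ w)         ≡⟨ residues-insertN u (v ++ S ∷ w) ⟩
    residues K (u ++ v ++ S ∷ w)                          ≡⟨ cong (residues K) (regroup u v w) ⟨
    residues K ((u ++ v ++ [ S ]) ++ w)                   ≡⟨ residues-insertN (u ++ v ++ [ S ]) w ⟨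
    residues K ((u ++ v ++ [ S ]) ++ replicate K N ++ w)  ∎
    where open ≡-Reasoning

  rightComp-inversions : ∀ {x y} → RightComp m k x y → inversions x < inversions y
  rightComp-inversions rc with rightComp-shape rc
  ... | u , v , w , refl , refl = begin-strict
    inversions (u ++ replicate K N ++ v ++ S ∷ w)          ≡⟨ inversions-insertN u K (v ++ S ∷ w) ⟩
    numS u * K + inversions (u ++ v ++ S ∷ w)              <⟨ +-monoˡ-< _ (*-monoˡ-< K numS-u<) ⟩
    numS (u ++ v ++ [ S ]) * K + inversions (u ++ v ++ S ∷ w) ≡⟨ cong (λ t → _ + inversions t) (regroup u v w) ⟨
    numS (u ++ v ++ [ S ]) * K + inversions ((u ++ v ++ [ S ]) ++ w) ≡⟨ inversions-insertN (u ++ v ++ [ S ]) K w ⟨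
    inversions ((u ++ v ++ [ S ]) ++ replicate K N ++ w)   ∎
    where
    open ≤-Reasoning
    numS-u< : numS u < numS (u ++ v ++ [ S ])
    numS-u< = begin-strict
      numS u                        <⟨ m<m+n (numS u) (s≤s z≤n) ⟩
      numS u + suc (numS v)         ≡⟨ cong (numS u +_) (+-comm 1 (numS v)) ⟩
      numS u + (numS v + numS [ S ]) ≡⟨ cong (numS u +_) (numS-++ v [ S ]) ⟨
      numS u + numS (v ++ [ S ])    ≡⟨ numS-++ u (v ++ [ S ]) ⟨
      numS (u ++ v ++ [ S ])        ∎

  kEquiv-residues : ∀ {x y} → KEquiv m k x y → residues K x ≡ residues K y
  kEquiv-residues = EQ.gfold isEquivalence (residues K) rightComp-residues

joinDn : List (List BigStep) → List BigStep
joinDn = intercalate [ Dn ]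

Us : ℕ → List BigStep
Us j = replicate j U

leadingUs : List BigStep → ℕ
leadingUs (U ∷ bs) = suc (leadingUs bs)
leadingUs _        = 0

leadingUs-++-Dn : ∀ xs ys → leadingUs (xs ++ Dn ∷ ys) ≡ leadingUs xs
leadingUs-++-Dn []        ys = refl
leadingUs-++-Dn (U ∷ xs)  ys = cong suc (leadingUs-++-Dn xs ys)
leadingUs-++-Dn (Dn ∷ xs) ys = refl

leadingUs-joinDn : ∀ C Cs → leadingUs (joinDn (C ∷ Cs)) ≡ leadingUs C
leadingUs-joinDn C []       = refl
leadingUs-joinDn C (D ∷ Cs) = leadingUs-++-Dn C _

leadingUs-split : ∀ j d → j ≤ leadingUs d → ∃[ R ] d ≡ Us j ++ R
leadingUs-split zero    d        _         = d , refl
leadingUs-split (suc j) (U ∷ d) (s≤s j≤d) with leadingUs-split j d j≤d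
... | R , refl = R , refl

module Paths (r : ℕ) where

  Reach : ℕ → List BigStep → ℕ → Set
  Reach h       []        e = h ≡ e
  Reach h       (U ∷ bs)  e = Reach (h + r) bs e
  Reach zero    (Dn ∷ bs) e = ⊥
  Reach (suc h) (Dn ∷ bs) e = Reach h bs e

  Dyck : List BigStep → Set
  Dyck bs = Reach 0 bs 0

  ballot⇒reach : ∀ h bs → Ballot r h bs → Reach h bs 0
  ballot⇒reach h       []        b = b
  ballot⇒reach h       (U ∷ bs)  b = ballot⇒reach (h + r) bs b
  ballot⇒reach (suc h) (Dn ∷ bs) b = ballot⇒reach h bs b

  reach⇒ballot : ∀ h bs → Reach h bs 0 → Ballot r h bs
  reach⇒ballot h       []        p = p
  reach⇒ballot h       (U ∷ bs)  p = reach⇒ballot (h + r) bs p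
  reach⇒ballot (suc h) (Dn ∷ bs) p = reach⇒ballot h bs p

  reach-++ : ∀ h xs {e} ys {f} → Reach h xs e → Reach e ys f → Reach h (xs ++ ys) f
  reach-++ h       []        ys refl q = q
  reach-++ h       (U ∷ xs)  ys p    q = reach-++ (h + r) xs ys p q
  reach-++ (suc h) (Dn ∷ xs) ys p    q = reach-++ h xs ys p q

  reach-++⁻ : ∀ h xs ys {f} → Reach h (xs ++ ys) f → ∃[ e ] Reach h xs e × Reach e ys f
  reach-++⁻ h       []        ys p = h , refl , p
  reach-++⁻ h       (U ∷ xs)  ys p = reach-++⁻ (h + r) xs ys p
  reach-++⁻ (suc h) (Dn ∷ xs) ys p = reach-++⁻ h xs ys p

  reach-functional : ∀ h xs {e e′} → Reach h xs e → Reach h xs e′ → e ≡ e′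
  reach-functional h       []        p q = trans (sym p) q
  reach-functional h       (U ∷ xs)  p q = reach-functional (h + r) xs p q
  reach-functional (suc h) (Dn ∷ xs) p q = reach-functional h xs p q

  reach-+ʳ : ∀ c h xs {e} → Reach h xs e → Reach (h + c) xs (e + c)
  reach-+ʳ c h       []        p = cong (_+ c) p
  reach-+ʳ c h       (U ∷ xs)  {e} p = subst (λ t → Reach t xs (e + c)) (xy∙z≈xz∙y h r c) (reach-+ʳ c (h + r) xs p)
  reach-+ʳ c (suc h) (Dn ∷ xs) p = reach-+ʳ c h xs p

  dyck-reach : ∀ a c → Dyck c → Reach a c a
  dyck-reach a c = reach-+ʳ a 0 c

  reach-Us⁻ : ∀ j h xs {e} → Reach h (Us j ++ xs) e → Reach (h + j * r) xs e
  reach-Us⁻ zero    h xs {e} p = subst (λ t → Reach t xs e) (sym (+-identityʳ h)) p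
  reach-Us⁻ (suc j) h xs {e} p = subst (λ t → Reach t xs e) (+-assoc h r (j * r)) (reach-Us⁻ j (h + r) xs p)

  reach-Us : ∀ j h xs {e} → Reach (h + j * r) xs e → Reach h (Us j ++ xs) e
  reach-Us zero    h xs {e} p = subst (λ t → Reach t xs e) (+-identityʳ h) p
  reach-Us (suc j) h xs {e} p = reach-Us j (h + r) xs (subst (λ t → Reach t xs e) (sym (+-assoc h r (j * r))) p)

  reach-dyck-middle : ∀ h p c q {e} → Reach h (p ++ c ++ q) e → Dyck c → ∃[ a ] Reach h p a × Reach a q e
  reach-dyck-middle h p c q {e} R dc with reach-++⁻ h p (c ++ q) R
  ... | a , Rp , Rcq with reach-++⁻ a c q Rcq
  ... | b , Rc , Rq = a , Rp , subst (λ t → Reach t q e) (reach-functional a c Rc (dyck-reach a c dc)) Rq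

  reach-replace : ∀ h p c c′ q {e} → Reach h (p ++ c ++ q) e → Dyck c → Dyck c′ → Reach h (p ++ c′ ++ q) e
  reach-replace h p c c′ q R dc dc′ with reach-dyck-middle h p c q R dc
  ... | a , Rp , Rq = reach-++ h p (c′ ++ q) Rp (reach-++ a c′ q (dyck-reach a c′ dc′) Rq)

  reach-moveUs : ∀ j h p c z {e} → Reach h (p ++ c ++ Dn ∷ Us j ++ z) e → Dyck c →
                 Reach h (p ++ Us j ++ c ++ Dn ∷ z) e
  reach-moveUs j h p c z R dc with reach-dyck-middle h p c (Dn ∷ Us j ++ z) R dc
  ... | suc a , Rp , Rz = reach-++ h p (Us j ++ c ++ Dn ∷ z) Rp
        (reach-Us j (suc a) (c ++ Dn ∷ z) (reach-++ _ c (Dn ∷ z) (dyck-reach _ c dc) (reach-Us⁻ j a z Rz)))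

  first-passage : ∀ h e bs → Reach (suc h + e) bs 0 →
    ∃[ E ] ∃[ rest ] bs ≡ E ++ Dn ∷ rest × Reach e E 0 × Reach h rest 0
  first-passage h e       (U ∷ bs)  p with first-passage h (e + r) bs (subst (λ t → Reach t bs 0) (+-assoc (suc h) e r) p)
  ... | E , rest , refl , RE , Rrest = U ∷ E , rest , refl , RE , Rrest
  first-passage h zero    (Dn ∷ bs) p = [] , bs , refl , refl , subst (λ t → Reach t bs 0) (+-identityʳ h) p
  first-passage h (suc e) (Dn ∷ bs) p with first-passage h e bs (subst (λ t → Reach t bs 0) (+-suc h e) p)
  ... | E , rest , refl , RE , Rrest = Dn ∷ E , rest , refl , RE , Rrest

  reach-pieces : ∀ c bs → Reach c bs 0 → ∃[ Cs ] length Cs ≡ suc c × bs ≡ joinDn Cs × All Dyck Cs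
  reach-pieces zero    bs p = bs ∷ [] , refl , refl , p ∷ []
  reach-pieces (suc c) bs p with first-passage c 0 bs (subst (λ t → Reach t bs 0) (cong suc (sym (+-identityʳ c))) p)
  ... | E , rest , refl , dE , Rrest with reach-pieces c rest Rrest
  ... | C ∷ Cs , len , refl , dCs = E ∷ C ∷ Cs , cong suc len , refl , dE ∷ dCs

  pieces-reach : ∀ c Cs → length Cs ≡ suc c → All Dyck Cs → Reach c (joinDn Cs) 0
  pieces-reach zero    (C ∷ [])     _   (dC ∷ [])  = dC
  pieces-reach (suc c) (C ∷ D ∷ Cs) len (dC ∷ dCs) =
    reach-++ (suc c) C (Dn ∷ joinDn (D ∷ Cs)) (dyck-reach (suc c) C dC) (pieces-reach c (D ∷ Cs) (suc-injective len) dCs)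

  data DyckTree : List BigStep → Set where
    leaf : DyckTree []
    node : ∀ Cs → length Cs ≡ suc r → All DyckTree Cs → DyckTree (U ∷ joinDn Cs)

  pieces-shorter : ∀ Cs → All (λ C → length C ≤ length (joinDn Cs)) Cs
  pieces-shorter []           = []
  pieces-shorter (C ∷ [])     = ≤-refl ∷ []
  pieces-shorter (C ∷ D ∷ Cs) = length-++-≤ˡ C ∷
    All.map (λ ℓ≤ → ≤-trans ℓ≤ (≤-trans (n≤1+n _) (length-++-≤ʳ (Dn ∷ joinDn (D ∷ Cs)) {C}))) (pieces-shorter (D ∷ Cs))

  mutual
    toTree : ∀ n bs → length bs ≤ n → Dyck bs → DyckTree bs
    toTree n       []        _         _ = leaf
    toTree (suc n) (U ∷ bs)  (s≤s ℓ≤n) p with reach-pieces r bs p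
    ... | Cs , len , refl , dCs =
      node Cs len (toTrees n Cs (All.map (λ ℓ≤ → ≤-trans ℓ≤ ℓ≤n) (pieces-shorter Cs)) dCs)

    toTrees : ∀ n Cs → All (λ C → length C ≤ n) Cs → All Dyck Cs → All DyckTree Cs
    toTrees n []       []         []         = []
    toTrees n (C ∷ Cs) (ℓ≤n ∷ ℓs) (dC ∷ dCs) = toTree n C ℓ≤n dC ∷ toTrees n Cs ℓs dCs

  mutual
    tree⇒dyck : ∀ {bs} → DyckTree bs → Dyck bs
    tree⇒dyck leaf              = refl
    tree⇒dyck (node Cs len ts) = pieces-reach r Cs len (trees⇒dyck ts)

    trees⇒dyck : ∀ {Cs} → All DyckTree Cs → All Dyck Cs
    trees⇒dyck []       = []
    trees⇒dyck (t ∷ ts) = tree⇒dyck t ∷ trees⇒dyck ts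

  flatten-++ : ∀ xs ys → flatten r (xs ++ ys) ≡ flatten r xs ++ flatten r ys
  flatten-++ []        ys = refl
  flatten-++ (U ∷ xs)  ys = trans (cong (replicate r N ++_) (flatten-++ xs ys)) (sym (++-assoc (replicate r N) _ _))
  flatten-++ (Dn ∷ xs) ys = cong (S ∷_) (flatten-++ xs ys)

  flatten-Us : ∀ j xs → flatten r (Us j ++ xs) ≡ replicate (j * r) N ++ flatten r xs
  flatten-Us zero    xs = refl
  flatten-Us (suc j) xs = begin
    replicate r N ++ flatten r (Us j ++ xs)             ≡⟨ cong (replicate r N ++_) (flatten-Us j xs) ⟩
    replicate r N ++ replicate (j * r) N ++ flatten r xs ≡⟨ ++-assoc (replicate r N) _ _ ⟨
    (replicate r N ++ replicate (j * r) N) ++ flatten r xs ≡⟨ cong (_++ flatten r xs) (replicate-+ r (j * r) N) ⟨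
    replicate (r + j * r) N ++ flatten r xs              ∎
    where open ≡-Reasoning

  flatten-joinDn : ∀ Cs → flatten r (joinDn Cs) ≡ intercalate [ S ] (map (flatten r) Cs)
  flatten-joinDn []           = refl
  flatten-joinDn (C ∷ [])     = refl
  flatten-joinDn (C ∷ D ∷ Cs) =
    trans (flatten-++ C (Dn ∷ joinDn (D ∷ Cs))) (cong (λ t → flatten r C ++ S ∷ t) (flatten-joinDn (D ∷ Cs)))

  dyck⇒IsDyck : ∀ bs → Dyck bs → IsDyck r (flatten r bs)
  dyck⇒IsDyck bs p = bs , refl , reach⇒ballot 0 bs p

  dycks⇒IsDyck : ∀ {Cs} → All Dyck Cs → All (IsDyck r) (map (flatten r) Cs)
  dycks⇒IsDyck {[]}     []       = []
  dycks⇒IsDyck {C ∷ Cs} (p ∷ ps) = dyck⇒IsDyck C p ∷ dycks⇒IsDyck ps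

  reach-numN : ∀ h bs → Reach h bs 0 → h + numN (flatten r bs) ≡ numS (flatten r bs)
  reach-numN h []        p = trans (+-identityʳ h) p
  reach-numN h (U ∷ bs)  p = begin
    h + numN (replicate r N ++ flatten r bs) ≡⟨ cong (h +_) (numN-insertN [] r (flatten r bs)) ⟩
    h + (r + numN (flatten r bs))             ≡⟨ +-assoc h r _ ⟨
    h + r + numN (flatten r bs)               ≡⟨ reach-numN (h + r) bs p ⟩
    numS (flatten r bs)                       ≡⟨ numS-insertN [] r (flatten r bs) ⟨
    numS (replicate r N ++ flatten r bs)      ∎
    where open ≡-Reasoning
  reach-numN (suc h) (Dn ∷ bs) p = cong suc (reach-numN h bs p)

  dyck-dseq-balance : ∀ bs {a T} → Dyck bs → dseq (flatten r bs) ≡ a ∷ T → a + sum T ≡ length T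
  dyck-dseq-balance bs {a} {T} p eq = suc-injective (begin
    suc (a + sum T)                 ≡⟨ cong (λ l → suc (sum l)) eq ⟨
    suc (sum (dseq w))              ≡⟨ cong suc (sum-dseq w) ⟩
    suc (numN w)                    ≡⟨ cong suc (reach-numN 0 bs p) ⟩
    suc (numS w)                    ≡⟨ length-dseq w ⟨
    length (dseq w)                 ≡⟨ cong length eq ⟩
    suc (length T)                  ∎)
    where
    open ≡-Reasoning
    w : Word
    w = flatten r bs

module Normalization (r′ k′ : ℕ) where

  r m k K : ℕ
  r = suc r′
  m = suc r
  k = suc k′
  K = k * r

  open Paths r

  f : List BigStep → Word
  f = flatten r

  -- d_i < K for every i ≥ 2, phrased on the big steps: after each down-step fewer than k up-steps follow.
  Normal : List BigStep → Set
  Normal []        = ⊤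
  Normal (U ∷ bs)  = Normal bs
  Normal (Dn ∷ bs) = leadingUs bs < k × Normal bs

  normal-++-Dn : ∀ xs ys → Normal xs → leadingUs ys < k → Normal ys → Normal (xs ++ Dn ∷ ys)
  normal-++-Dn []        ys _         ys<k nys = ys<k , nys
  normal-++-Dn (U ∷ xs)  ys nxs       ys<k nys = normal-++-Dn xs ys nxs ys<k nys
  normal-++-Dn (Dn ∷ xs) ys (x<k , nxs) ys<k nys =
    subst (_< k) (sym (leadingUs-++-Dn xs ys)) x<k , normal-++-Dn xs ys nxs ys<k nys

  LeftReducible : List BigStep → Set
  LeftReducible bs = ∃[ bs′ ] Dyck bs′ × RightComp m k (f bs′) (f bs)

  flatten-node : ∀ Cs → f (U ∷ joinDn Cs) ≡ replicate r N ++ intercalate [ S ] (map f Cs)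
  flatten-node Cs = cong (replicate r N ++_) (flatten-joinDn Cs)

  node-split : ∀ A c B → U ∷ joinDn (A ++ c ∷ B) ≡ (U ∷ sepAfter Dn A) ++ c ++ concatMap (Dn ∷_) B
  node-split A c B = cong (U ∷_) (trans (intercalate-++-∷ Dn A c B) (cong (sepAfter Dn A ++_) (intercalate-∷ Dn c B)))

  reducible-child : ∀ A c B → Dyck (U ∷ joinDn (A ++ c ∷ B)) → Dyck c → LeftReducible c →
                    LeftReducible (U ∷ joinDn (A ++ c ∷ B))
  reducible-child A c B D dc (c′ , dc′ , rc) =
    U ∷ joinDn (A ++ c′ ∷ B) ,
    subst Dyck (sym (node-split A c′ B)) (reach-replace 0 P c c′ Q (subst Dyck (node-split A c B) D) dc dc′) ,
    subst₂ (RightComp m k) (sym (flat c′)) (sym (flat c)) (rightComp-context (f P) (f Q) rc)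
    where
    P Q : List BigStep
    P = U ∷ sepAfter Dn A
    Q = concatMap (Dn ∷_) B
    flat : ∀ z → f (U ∷ joinDn (A ++ z ∷ B)) ≡ f P ++ f z ++ f Q
    flat z = trans (cong f (node-split A z B)) (trans (flatten-++ P (z ++ Q)) (cong (f P ++_) (flatten-++ z Q)))

  -- The child Uᵏ E Dn E₁ … Dn E_K (above height K it splits into K + 1 Dyck pieces) passes its Uᵏ to its
  -- left sibling c: a left compression, after which E, E₁, …, E_K are children of the node.
  reducible-node : ∀ A c E Es B → length A + 2 + length B ≡ suc r → length Es ≡ K →
    All Dyck A → Dyck c → Dyck E → All Dyck Es → All Dyck B →
    Dyck (U ∷ joinDn (A ++ c ∷ (Us k ++ E) ∷ Es ++ B)) →
    LeftReducible (U ∷ joinDn (A ++ c ∷ (Us k ++ E) ∷ Es ++ B))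
  reducible-node A c E Es B lenAB lenEs dA dc dE dEs dB D =
    U ∷ joinDn (A ++ (Us k ++ c) ∷ E ∷ Es ++ B) ,
    subst Dyck (sym new-split) (reach-moveUs k 0 P c Z (subst Dyck old-split D) dc) ,
    subst₂ (RightComp m k) (sym (flat (Us k ++ c) E (flatten-Us k c) refl)) (sym (flat c (Us k ++ E) refl (flatten-Us k E)))
      (rightComp-whole (map f A) (f c) (f E) (map f (Es ++ B)) ℓ₁ ℓ₂
        (dycks⇒IsDyck dA) (dyck⇒IsDyck c dc) (dyck⇒IsDyck E dE) (dycks⇒IsDyck (All.++⁺ dEs dB)))
    where
    P Z : List BigStep
    P = U ∷ sepAfter Dn A
    Z = joinDn (E ∷ Es ++ B)

    old-split : U ∷ joinDn (A ++ c ∷ (Us k ++ E) ∷ Es ++ B) ≡ P ++ c ++ Dn ∷ Us k ++ Z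
    old-split = cong (U ∷_) (trans (intercalate-++-∷ Dn A c _)
                  (cong (λ t → sepAfter Dn A ++ c ++ Dn ∷ t) (intercalate-++ˡ Dn (Us k) E (Es ++ B))))

    new-split : U ∷ joinDn (A ++ (Us k ++ c) ∷ E ∷ Es ++ B) ≡ P ++ Us k ++ c ++ Dn ∷ Z
    new-split = cong (U ∷_) (trans (intercalate-++-∷ Dn A (Us k ++ c) _)
                  (cong (sepAfter Dn A ++_) (intercalate-++ˡ Dn (Us k) c (E ∷ Es ++ B))))

    flat : ∀ X Y {X′ Y′} → f X ≡ X′ → f Y ≡ Y′ →
           f (U ∷ joinDn (A ++ X ∷ Y ∷ Es ++ B)) ≡ replicate r N ++ intercalate [ S ] (map f A ++ X′ ∷ Y′ ∷ map f (Es ++ B))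
    flat X Y refl refl = trans (flatten-node (A ++ X ∷ Y ∷ Es ++ B)) (cong (λ t → replicate r N ++ intercalate [ S ] t) (map-++ f A _))

    ℓ₁ : length (map f A) + 2 ≤ m
    ℓ₁ = begin
      length (map f A) + 2          ≡⟨ cong (_+ 2) (length-map f A) ⟩
      length A + 2                  ≤⟨ m≤m+n _ (length B) ⟩
      length A + 2 + length B       ≡⟨ lenAB ⟩
      m                             ∎
      where open ≤-Reasoning

    ℓ₂ : length (map f A) + 2 + length (map f (Es ++ B)) ≡ m + K
    ℓ₂ = begin
      length (map f A) + 2 + length (map f (Es ++ B)) ≡⟨ cong₂ (λ a e → a + 2 + e) (length-map f A) (trans (length-map f (Es ++ B)) (length-++ Es)) ⟩
      length A + 2 + (length Es + length B)           ≡⟨ x∙yz≈xz∙y (length A + 2) (length Es) (length B) ⟩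
      length A + 2 + length B + length Es             ≡⟨ cong₂ _+_ lenAB lenEs ⟩
      m + K                                           ∎
      where open ≡-Reasoning

  reducible-some-child : ∀ Cs → Dyck (U ∷ joinDn Cs) → All Dyck Cs → Any LeftReducible Cs →
                         LeftReducible (U ∷ joinDn Cs)
  reducible-some-child Cs D dCs red with find red
  ... | c , c∈Cs , c-red with ∈-∃++ c∈Cs
  ... | A , B , refl = reducible-child A c B D (All.lookup dCs c∈Cs) c-red

  reducible-tall-child : ∀ A c d B → length (A ++ c ∷ d ∷ B) ≡ suc r → All Dyck (A ++ c ∷ d ∷ B) →
    Dyck (U ∷ joinDn (A ++ c ∷ d ∷ B)) → k ≤ leadingUs d → LeftReducible (U ∷ joinDn (A ++ c ∷ d ∷ B))
  reducible-tall-child A c d B len dCs D k≤d with leadingUs-split k d k≤d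
  ... | R , refl with All.++⁻ʳ A dCs
  ... | dc ∷ dd ∷ dB with reach-pieces K R (reach-Us⁻ k 0 R dd)
  ... | E ∷ Es , lenEs , refl , dE ∷ dEs =
    subst LeftReducible (sym regroup)
      (reducible-node A c E Es B lenAB (suc-injective lenEs) (All.++⁻ˡ A dCs) dc dE dEs dB (subst Dyck regroup D))
    where
    regroup : U ∷ joinDn (A ++ c ∷ (Us k ++ joinDn (E ∷ Es)) ∷ B) ≡ U ∷ joinDn (A ++ c ∷ (Us k ++ E) ∷ Es ++ B)
    regroup = cong (U ∷_) (intercalate-regroup Dn A c (Us k) E Es B)
    lenAB : length A + 2 + length B ≡ suc r
    lenAB = trans (+-assoc (length A) 2 (length B)) (trans (sym (length-++ A)) len)

  normal-or-tall : ∀ Cs → All Normal Cs →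
    Normal (joinDn Cs) ⊎ ∃[ A ] ∃[ c ] ∃[ d ] ∃[ B ] Cs ≡ A ++ c ∷ d ∷ B × k ≤ leadingUs d
  normal-or-tall []           []         = inj₁ tt
  normal-or-tall (C ∷ [])     (nC ∷ [])  = inj₁ nC
  normal-or-tall (C ∷ D ∷ Cs) (nC ∷ nCs) with k ≤? leadingUs D
  ... | yes k≤D = inj₂ ([] , C , D , Cs , refl , k≤D)
  ... | no  k≰D with normal-or-tall (D ∷ Cs) nCs
  ...   | inj₁ nJ = inj₁ (normal-++-Dn C _ nC (subst (_< k) (sym (leadingUs-joinDn D Cs)) (≰⇒> k≰D)) nJ)
  ...   | inj₂ (A , c , d , B , eq , k≤d) = inj₂ (C ∷ A , c , d , B , cong (C ∷_) eq , k≤d)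

  mutual
    normal-or-reducible : ∀ {bs} → DyckTree bs → Normal bs ⊎ LeftReducible bs
    normal-or-reducible leaf = inj₁ tt
    normal-or-reducible t@(node Cs len ts) with normal-or-reducible-children ts
    ... | inj₂ red = inj₂ (reducible-some-child Cs (tree⇒dyck t) (trees⇒dyck ts) red)
    ... | inj₁ ns with normal-or-tall Cs ns
    ...   | inj₁ n = inj₁ n
    ...   | inj₂ (A , c , d , B , refl , k≤d) = inj₂ (reducible-tall-child A c d B len (trees⇒dyck ts) (tree⇒dyck t) k≤d)

    normal-or-reducible-children : ∀ {Cs} → All DyckTree Cs → All Normal Cs ⊎ Any LeftReducible Cs
    normal-or-reducible-children []       = inj₁ []
    normal-or-reducible-children (t ∷ ts) with normal-or-reducible t | normal-or-reducible-children ts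
    ... | inj₂ red | _        = inj₂ (here red)
    ... | inj₁ n   | inj₁ ns  = inj₁ (n ∷ ns)
    ... | inj₁ _   | inj₂ red = inj₂ (there red)

  normalize : ∀ bs → Dyck bs → Acc _<_ (inversions (f bs)) →
              ∃[ e ] Dyck e × Normal e × KEquiv m k (f bs) (f e)
  normalize bs D (acc rs) with normal-or-reducible (toTree (length bs) bs ≤-refl D)
  ... | inj₁ n = bs , D , n , ε
  ... | inj₂ (bs′ , D′ , rc) with normalize bs′ D′ (rs (rightComp-inversions rc))
  ...   | e , De , ne , bs′~e = e , De , ne , bwd rc ◅ bs′~e

  normal-dseq : ∀ bs → Normal bs → ∃[ T ] dseq (f bs) ≡ leadingUs bs * r ∷ T × All (_< K) T
  normal-dseq []        _          = [] , refl , []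
  normal-dseq (U ∷ bs)  nbs        with normal-dseq bs nbs
  ... | T , eq , T<K = T , trans (dseq-insertN [] r (f bs)) (cong (addAt 0 r) eq) , T<K
  normal-dseq (Dn ∷ bs) (b<k , nbs) with normal-dseq bs nbs
  ... | T , eq , T<K = leadingUs bs * r ∷ T , cong (0 ∷_) eq , *-monoˡ-< r b<k ∷ T<K

  -- Residues fix all entries but the first (they are < K); the first is then fixed by Σ d_i = #S.
  normal-unique : ∀ e e′ → Dyck e → Dyck e′ → Normal e → Normal e′ →
                  residues K (f e) ≡ residues K (f e′) → f e ≡ f e′
  normal-unique e e′ De De′ ne ne′ res
    with normal-dseq e ne | normal-dseq e′ ne′
  ... | T , eq , T<K | T′ , eq′ , T′<K = dseq-injective (trans eq (trans (cong₂ _∷_ heads tails) (sym eq′)))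
    where
    tails : T ≡ T′
    tails = trans (sym (map-%-small T<K))
              (trans (∷-injectiveʳ (trans (sym (cong (map (_% K)) eq)) (trans res (cong (map (_% K)) eq′))))
                     (map-%-small T′<K))
    heads : leadingUs e * r ≡ leadingUs e′ * r
    heads = +-cancelʳ-≡ (sum T) _ _ (trans (dyck-dseq-balance e De eq)
              (trans (cong length tails) (trans (sym (dyck-dseq-balance e′ De′ eq′)) (cong (λ t → _ + sum t) (sym tails)))))

  residues≡⇒KEquiv : ∀ bs bs′ → Dyck bs → Dyck bs′ → residues K (f bs) ≡ residues K (f bs′) → KEquiv m k (f bs) (f bs′)
  residues≡⇒KEquiv bs bs′ D D′ res with normalize bs D (<-wellFounded _) | normalize bs′ D′ (<-wellFounded _)
  ... | e , De , ne , bs~e | e′ , De′ , ne′ , bs′~e′ =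
    bs~e ◅◅ subst (λ w → KEquiv m k w (f bs′)) (sym same) (EQ.symmetric (RightComp m k) bs′~e′)
    where
    same : f e ≡ f e′
    same = normal-unique e e′ De De′ ne ne′ (trans (sym (kEquiv-residues bs~e)) (trans res (kEquiv-residues bs′~e′)))

theorem3p15 : (m k g : ℕ) → 2 ≤ m → 1 ≤ k → (D D' : Word) →
    IsDyck (m ∸ 1) D → IsDyck (m ∸ 1) D' →
    numS D ≡ (m + g * (m ∸ 1)) ∸ 1 → numS D' ≡ (m + g * (m ∸ 1)) ∸ 1 →
    (KEquiv m k D D' ⇔ Pointwise (λ a b → a ≡ b [mod k * (m ∸ 1) ]) (dseq D) (dseq D'))
theorem3p15 (suc (suc r′)) (suc k′) _ (s≤s (s≤s z≤n)) (s≤s z≤n) _ _ (bs , refl , bal) (bs′ , refl , bal′) _ _ =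
  mk⇔ (λ D~D′ → from (kEquiv-residues D~D′))
      (λ D≈D′ → residues≡⇒KEquiv bs bs′ (ballot⇒reach 0 bs bal) (ballot⇒reach 0 bs′ bal′) (to D≈D′))
  where
  open Normalization r′ k′
  open Paths r using (ballot⇒reach)
  open Equivalence (Pointwise-≡[mod]⇔map-% {K})
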